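{- Let $p$ be a prime with $p\notin\{2,3,7\}$. With the notation of the context: (1) $\chi_4^G=\mathrm{Ind}_{A_{4,(1)}}^G(\varepsilon_1)-\mathrm{Ind}_H^G(\varepsilon')$. (2) There exists $r_0\in\mathbb{Z}[1/2,1/3,1/7][G]$ with $e_4^G=\bigl(\sum_{i=1}^6 e_{\varepsilon_i}^{A_{4,(i)}}\bigr)r_0$. (3) For every $j\in\{1,\dots,6\}$ there exist $r_j\in e_{\varepsilon_j}^{A_{4,(j)}}\mathbb{Z}[G]$ and $r'_j\in\mathbb{Z}[1/2,1/7][G]$ such that $r_je_{\varepsilon_i}^{A_{4,(i)}}=0$ for all $i\in\{1,\dots,6\}\setminus\{j\}$ and $e_4^Ge_{\varepsilon_j}^{A_{4,(j)}}=r'_jr_je_4^Ge_{\varepsilon_j}^{A_{4,(j)}}$. (4) For every $i\in\{1,\dots,6\}$ there exists $g_i\in G$ with $e_{\varepsilon_1}^{A_{4,(1)}}=g_ie_{\varepsilon_i}^{A_{4,(i)}}g_i^{ -1}$. (5) There exist $q_1\in\mathbb{Z}[1/7][G]$ and $q_2\in\mathbb{Z}[1/2][G]$ with $(1-e_4^G)e_{\varepsilon_1}^{A_{4,(1)}}q_1=e_{\varepsilon_1}^{A_{4,(1)}}e_{\varepsilon'}^H$ and $(1-e_4^G)e_{\varepsilon_1}^{A_{4,(1)}}=e_{\varepsilon_1}^{A_{4,(1)}}e_{\varepsilon'}^Hq_2$; in particular $(1-e_4^G)e_{\varepsilon_1}^{A_{4,(1)}}\mathbb{Z}_p[G]=e_{\varepsilon_1}^{A_{4,(1)}}e_{\varepsilon'}^H\mathbb{Z}_p[G]$.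 (6) There exist $q_3\in\mathbb{Z}[G]$ and $q_4\in\mathbb{Z}[1/2][G]$ with $q_3e_{\varepsilon_1}^{A_{4,(1)}}e_{\varepsilon'}^H=e_{\varepsilon'}^H$ and $e_{\varepsilon_1}^{A_{4,(1)}}e_{\varepsilon'}^H=q_4e_{\varepsilon'}^H$; in particular $\mathbb{Z}_p[G]e_{\varepsilon_1}^{A_{4,(1)}}e_{\varepsilon'}^H=\mathbb{Z}_p[G]e_{\varepsilon'}^H$.
   Context: $G$ is the subgroup of $S_8$ generated by $(3,6,7)(4,5,8)$ and $(1,8,2)(4,5,6)$ (simple of order 168). Permutations are composed right to left. For $H\le G$ and a character $\psi$ of $H$, $e_\psi^H=\frac{\psi(1)}{\#H}\sum_{h\in H}\psi(h^{ -1})h$. Let $A_{4,(7)}=\langle(1,7,6)(2,5,4),(1,8)(2,4)(3,5)(6,7)\rangle\cong A_4$; $G$ has exactly seven subgroups conjugate to $A_{4,(7)}$, among them $A_{4,(1)}=\langle(2,6,4)(3,5,8),(1,2)(3,5)(4,6)(7,8)\rangle$; the remaining five are labelled $A_{4,(2)},\dots,A_{4,(6)}$ (in any order). Let $H=\langle(1,4,2)(5,8,7),(1,8,2,4,3,7,5)\rangle$ (order 21). $\varepsilon_i$ and $\varepsilon'$ are the trivial characters of $A_{4,(i)}$ and $H$. $\chi_4^G$ is the unique irreducible character of $G$ of degree 6 and $e_4^G=e_{\chi_4^G}^G$. -}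

module Defs where

open import Data.Nat as ℕ using (ℕ; zero; suc; _^_)
open import Data.Nat.Divisibility using (_∣_)
open import Data.Bool using (Bool; true; false; if_then_else_)
open import Data.Fin as Fin using (Fin; zero; suc; toℕ)
open import Data.Fin.Properties using () renaming (_≟_ to _≟F_)
open import Data.Vec using (Vec; tabulate; lookup)
open import Data.Vec.Properties using (≡-dec)
open import Data.List using (List; []; _∷_; _++_; [_]; map; concatMap; foldr; foldl; length; allFin)
open import Data.List.Membership.Propositional using (_∈_)
open import Data.List.Membership.DecPropositional using () renaming (_∈?_ to mem?)
open import Data.List.Relation.Unary.All using (All)
open import Data.Integer using (+_; -[1+_])
open import Data.Rational as ℚ using (ℚ; 0ℚ; 1ℚ; ↧ₙ_)
open import Data.Product using (_×_; _,_; ∃)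
open import Relation.Nullary using (¬_)
open import Relation.Nullary.Decidable using (⌊_⌋)
open import Relation.Binary.PropositionalEquality using (_≡_)
open import Relation.Binary.Definitions using (DecidableEquality)

-- Permutations of {1,…,8}.  Point k ∈ {1..8} is represented by the
-- element k-1 of Fin 8; a permutation σ is the vector of images,
-- lookup σ (k-1) = σ(k)-1.

Perm : Set
Perm = Vec (Fin 8) 8

_≟P_ : DecidableEquality Perm
_≟P_ = ≡-dec _≟F_

pt : ℕ → Fin 8
pt 2 = Fin.suc zero
pt 3 = Fin.suc (Fin.suc zero)
pt 4 = Fin.suc (Fin.suc (Fin.suc zero))
pt 5 = Fin.suc (Fin.suc (Fin.suc (Fin.suc zero)))
pt 6 = Fin.suc (Fin.suc (Fin.suc (Fin.suc (Fin.suc zero))))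
pt 7 = Fin.suc (Fin.suc (Fin.suc (Fin.suc (Fin.suc (Fin.suc zero)))))
pt 8 = Fin.suc (Fin.suc (Fin.suc (Fin.suc (Fin.suc (Fin.suc (Fin.suc zero))))))
pt _ = zero

-- image of x under the cycle (a₀ a₁ … aₖ) (first = a₀)
private
  nextIn : ℕ → List ℕ → ℕ → ℕ
  nextIn f [] x = x
  nextIn f (a ∷ []) x = if a ℕ.≡ᵇ x then f else x
  nextIn f (a ∷ b ∷ r) x = if a ℕ.≡ᵇ x then b else nextIn f (b ∷ r) x

applyCycle : List ℕ → ℕ → ℕ
applyCycle [] x = x
applyCycle (a ∷ r) x = nextIn a (a ∷ r) x

-- permutation given in cycle notation (1-based), product read right to left
cycles : List (List ℕ) → Perm
cycles cs = tabulate (λ i → pt (foldr applyCycle (suc (toℕ i)) cs))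

_∘ₚ_ : Perm → Perm → Perm
σ ∘ₚ τ = tabulate (λ i → lookup σ (lookup τ i))

idP : Perm
idP = tabulate (λ i → i)

invP : Perm → Perm
invP σ = tabulate (λ i → pre i (allFin 8))
  where
  pre : Fin 8 → List (Fin 8) → Fin 8
  pre i [] = zero
  pre i (j ∷ js) = if ⌊ lookup σ j ≟F i ⌋ then j else pre i js

-- The subgroup generated by a list of permutations, as the (duplicate-
-- free) list of its elements: closure of {id} under left multiplication
-- by the generators (in a finite group this is the generated subgroup).
-- Each round adds at least one new element until closed, so the fuel
-- 8! = 40320 suffices.

private
  addNew : Perm → List Perm → List Perm
  addNew y acc = if ⌊ mem? _≟P_ y acc ⌋ then acc else acc ++ [ y ]

  step : List Perm → List Perm → List Perm
  step gens S = foldl (λ acc x → foldl (λ acc′ s → addNew (s ∘ₚ x) acc′) acc gens) S S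

  iter : ℕ → List Perm → List Perm → List Perm
  iter zero gens S = S
  iter (suc n) gens S with step gens S
  ... | S′ = if length S′ ℕ.≡ᵇ length S then S else iter n gens S′

generated : List Perm → List Perm
generated gens = iter 40320 gens [ idP ]

Gel : List Perm
Gel = generated (cycles ((3 ∷ 6 ∷ 7 ∷ []) ∷ (4 ∷ 5 ∷ 8 ∷ []) ∷ [])
               ∷ cycles ((1 ∷ 8 ∷ 2 ∷ []) ∷ (4 ∷ 5 ∷ 6 ∷ []) ∷ []) ∷ [])

Hel : List Perm       -- H, order 21
Hel = generated (cycles ((1 ∷ 4 ∷ 2 ∷ []) ∷ (5 ∷ 8 ∷ 7 ∷ []) ∷ [])
               ∷ cycles ((1 ∷ 8 ∷ 2 ∷ 4 ∷ 3 ∷ 7 ∷ 5 ∷ []) ∷ []) ∷ [])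

A4-7 : List Perm
A4-7 = generated (cycles ((1 ∷ 7 ∷ 6 ∷ []) ∷ (2 ∷ 5 ∷ 4 ∷ []) ∷ [])
                ∷ cycles ((1 ∷ 8 ∷ []) ∷ (2 ∷ 4 ∷ []) ∷ (3 ∷ 5 ∷ []) ∷ (6 ∷ 7 ∷ []) ∷ []) ∷ [])

-- A_{4,(i+1)} for i : Fin 6.  A_{4,(1)} is the one of the context; the
-- other five G-conjugates of A_{4,(7)} (each generated by the conjugates
-- of the two generators of A_{4,(7)}) are labelled in a fixed order; the
-- statement is symmetric in the labels 2,…,6.
A4 : Fin 6 → List Perm
A4 zero = generated (cycles ((2 ∷ 6 ∷ 4 ∷ []) ∷ (3 ∷ 5 ∷ 8 ∷ []) ∷ [])
                   ∷ cycles ((1 ∷ 2 ∷ []) ∷ (3 ∷ 5 ∷ []) ∷ (4 ∷ 6 ∷ []) ∷ (7 ∷ 8 ∷ []) ∷ []) ∷ [])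
A4 (suc zero) = generated (cycles ((1 ∷ 8 ∷ 3 ∷ []) ∷ (4 ∷ 7 ∷ 6 ∷ []) ∷ [])
                   ∷ cycles ((1 ∷ 2 ∷ []) ∷ (3 ∷ 8 ∷ []) ∷ (4 ∷ 7 ∷ []) ∷ (5 ∷ 6 ∷ []) ∷ []) ∷ [])
A4 (suc (suc zero)) = generated (cycles ((2 ∷ 5 ∷ 6 ∷ []) ∷ (3 ∷ 4 ∷ 7 ∷ []) ∷ [])
                   ∷ cycles ((1 ∷ 7 ∷ []) ∷ (2 ∷ 8 ∷ []) ∷ (3 ∷ 4 ∷ []) ∷ (5 ∷ 6 ∷ []) ∷ []) ∷ [])
A4 (suc (suc (suc zero))) = generated (cycles ((1 ∷ 5 ∷ 6 ∷ []) ∷ (4 ∷ 7 ∷ 8 ∷ []) ∷ [])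
                   ∷ cycles ((1 ∷ 3 ∷ []) ∷ (2 ∷ 4 ∷ []) ∷ (5 ∷ 6 ∷ []) ∷ (7 ∷ 8 ∷ []) ∷ []) ∷ [])
A4 (suc (suc (suc (suc zero)))) = generated (cycles ((3 ∷ 6 ∷ 7 ∷ []) ∷ (4 ∷ 5 ∷ 8 ∷ []) ∷ [])
                   ∷ cycles ((1 ∷ 5 ∷ []) ∷ (2 ∷ 6 ∷ []) ∷ (3 ∷ 7 ∷ []) ∷ (4 ∷ 8 ∷ []) ∷ []) ∷ [])
A4 (suc (suc (suc (suc (suc zero))))) = generated (cycles ((1 ∷ 7 ∷ 5 ∷ []) ∷ (3 ∷ 6 ∷ 8 ∷ []) ∷ [])
                   ∷ cycles ((1 ∷ 2 ∷ []) ∷ (3 ∷ 4 ∷ []) ∷ (5 ∷ 7 ∷ []) ∷ (6 ∷ 8 ∷ []) ∷ []) ∷ [])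

sumℚ : List ℚ → ℚ
sumℚ = foldr ℚ._+_ 0ℚ

-- 1/n (n ≥ 1; value at 0 irrelevant)
recip : ℕ → ℚ
recip zero = 0ℚ
recip (suc n) = (+ 1) ℚ./ suc n

order : Perm → ℕ
order σ = go 40320 1 σ
  where
  go : ℕ → ℕ → Perm → ℕ
  go zero k τ = k
  go (suc f) k τ = if ⌊ τ ≟P idP ⌋ then k else go f (suc k) (σ ∘ₚ τ)

triv : Perm → ℚ
triv _ = 1ℚ

-- χ_4^G, the irreducible character of degree 6 of G ≅ PSL(2,7), given by
-- its row of the character table: classes are determined by element order
-- (1 ↦ 6, 2 ↦ 2, 3 ↦ 0, 4 ↦ 0, 7 ↦ -1).
chi4 : Perm → ℚ
chi4 σ = valOf (order σ)
  where
  valOf : ℕ → ℚ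
  valOf n = if n ℕ.≡ᵇ 1 then (+ 6) ℚ./ 1
            else if n ℕ.≡ᵇ 2 then (+ 2) ℚ./ 1
            else if n ℕ.≡ᵇ 7 then -[1+ 0 ] ℚ./ 1
            else 0ℚ

ext0 : List Perm → (Perm → ℚ) → Perm → ℚ
ext0 K ψ g = if ⌊ mem? _≟P_ g K ⌋ then ψ g else 0ℚ

Ind : List Perm → (Perm → ℚ) → Perm → ℚ
Ind K ψ g = recip (length K) ℚ.* sumℚ (map (λ x → ext0 K ψ ((invP x ∘ₚ g) ∘ₚ x)) Gel)

-- The group algebra ℚ[G] (inside ℚ[S₈]): formal finite sums Σ aᵢ gᵢ,
-- represented as lists of (coefficient, permutation) pairs.

QG : Set
QG = List (ℚ × Perm)

_+ᴳ_ : QG → QG → QG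
_+ᴳ_ = _++_

_*ᴳ_ : QG → QG → QG
x *ᴳ y = concatMap (λ { (a , g) → map (λ { (b , h) → (a ℚ.* b , g ∘ₚ h) }) y }) x

-ᴳ_ : QG → QG
-ᴳ_ = map (λ { (a , g) → (ℚ.- a , g) })

_-ᴳ_ : QG → QG → QG
x -ᴳ y = x +ᴳ (-ᴳ y)

0ᴳ : QG
0ᴳ = []

1ᴳ : QG
1ᴳ = [ (1ℚ , idP) ]

⟪_⟫ : Perm → QG
⟪ g ⟫ = [ (1ℚ , g) ]

sumᴳ : List QG → QG
sumᴳ = foldr _+ᴳ_ 0ᴳ

coeff : QG → Perm → ℚ
coeff x g = sumℚ (map (λ { (a , h) → if ⌊ h ≟P g ⌋ then a else 0ℚ }) x)

-- equality in ℚ[G]: equal coefficients at every element of G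
-- (all elements compared below are supported on G)
infix 4 _≈ᴳ_
_≈ᴳ_ : QG → QG → Set
x ≈ᴳ y = ∀ g → g ∈ Gel → coeff x g ≡ coeff y g

_∈[_][G] : QG → (ℚ → Set) → Set
x ∈[ R ][G] = All (λ { (a , g) → R a × g ∈ Gel }) x

-- ℤ[1/m] = rationals whose denominator divides a power of m
-- (ℤ[1/1] = ℤ; ℤ[1/42] = ℤ[1/2,1/3,1/7]; ℤ[1/14] = ℤ[1/2,1/7])
ℤ[1/_] : ℕ → ℚ → Set
ℤ[1/ m ] q = ∃ λ k → (↧ₙ q) ∣ m ^ k

ℤ₍_₎ : ℕ → ℚ → Set
ℤ₍ p ₎ q = ¬ (p ∣ ↧ₙ q)

eIdem : List Perm → (Perm → ℚ) → QG
eIdem K ψ = map (λ h → (ψ idP ℚ.* recip (length K) ℚ.* ψ (invP h) , h)) K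

eA : Fin 6 → QG
eA i = eIdem (A4 i) triv

eH : QG
eH = eIdem Hel triv

e4 : QG
e4 = eIdem Gel chi4

-- Everything is a finite computation once witnesses are fixed: (1) compares two class
-- functions at the 168 elements of G, the other parts are identities in ℚ[S₈] and
-- membership of coefficients in ℤ[1/m].  An element of ℚ[S₈] is normalised by inserting
-- its terms into a trie keyed by the permutation (merging equal keys, dropping zero
-- coefficients); x ≈ y is certified by x - y normalising to the empty sum, and
-- normalising the left factor of a product first keeps the large products of (3) and
-- (5) small.  The witness r₀ comes from the quadratic relation satisfied by (Σᵢ eᵢ) e₄
-- in e₄ℚ[G]; the others solve small linear systems.  The p-local statements follow
-- from ℤ[1/m] ⊆ ℤ₍p₎ for primes p not dividing m.

module Submission where

open import Defs
open import Data.Nat as ℕ using (ℕ; zero; suc; _^_; nonTrivial⇒≢1)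
open import Data.Nat.Divisibility using (_∣_; _∣?_; ∣-trans; ∣1⇒≡1)
open import Data.Nat.Primality using (Prime; euclidsLemma; prime⇒irreducible; prime⇒nonTrivial; prime[2]; prime?)
open import Data.Bool using (true; if_then_else_)
open import Data.Unit using (tt)
open import Data.Fin as Fin using (Fin; zero; suc)
import Data.Fin.Properties as Fin
open import Data.Vec as Vec using (Vec; _∷_; [])
open import Data.List as List using (List; _∷_; []; [_]; _++_; map; foldr; allFin; length)
import Data.List.Properties as List
open import Data.List.Relation.Unary.All as All using (All)
open import Data.List.Membership.Propositional using (_∈_)
open import Data.List.Membership.DecPropositional _≟P_ using (_∈?_)
open import Data.Product using (_×_; ∃; _,_; proj₁; proj₂)
open import Data.Sum using ([_,_]′)
open import Data.Integer using (+_)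
import Data.Integer.Literals as ℤ
open import Data.Rational as ℚ using (ℚ; 0ℚ; 1ℚ; _/_; ↧ₙ_)
import Data.Rational.Properties as ℚ
open import Algebra.Bundles using (CommutativeMonoid)
open import Algebra.Properties.CommutativeSemigroup (CommutativeMonoid.commutativeSemigroup ℚ.+-0-commutativeMonoid) using (x∙yz≈y∙xz)
open import Algebra.Properties.Group ℚ.+-0-group using (x∙y⁻¹≈ε⇒x≈y; identityʳ-unique)
open import Function using (id)
open import Relation.Nullary using (Dec; yes; no; does; ¬_; ¬?; contradiction)
open import Relation.Nullary.Decidable using (⌊_⌋; _×-dec_; _→-dec_)
open import Relation.Binary.Definitions using (DecidableEquality)
open import Relation.Binary.PropositionalEquality using (_≡_; _≢_; refl; sym; trans; cong; cong₂; subst; module ≡-Reasoning)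
open ≡-Reasoning

-- Negative integer literals such as -3; their instance asks for an instance of ⊤.
instance
  _ = ℤ.negative
  _ = tt

Σ⟨_⟩ : {K : Set} → (ℚ → K → ℚ) → List (ℚ × K) → ℚ
Σ⟨ φ ⟩ x = sumℚ (map (λ (a , h) → φ a h) x)

Additive : {K : Set} → (ℚ → K → ℚ) → Set
Additive φ = ∀ a b h → φ (a ℚ.+ b) h ≡ φ a h ℚ.+ φ b h

additive-zero : {K : Set} {φ : ℚ → K → ℚ} → Additive φ → ∀ h → φ 0ℚ h ≡ 0ℚ
additive-zero {φ = φ} additive h = identityʳ-unique (φ 0ℚ h) (φ 0ℚ h) (sym (additive 0ℚ 0ℚ h))

Σ-++ : {K : Set} (φ : ℚ → K → ℚ) (x y : List (ℚ × K)) → Σ⟨ φ ⟩ (x ++ y) ≡ Σ⟨ φ ⟩ x ℚ.+ Σ⟨ φ ⟩ y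
Σ-++ φ [] y = sym (ℚ.+-identityˡ (Σ⟨ φ ⟩ y))
Σ-++ φ ((a , h) ∷ x) y = trans (cong (φ a h ℚ.+_) (Σ-++ φ x y)) (sym (ℚ.+-assoc (φ a h) (Σ⟨ φ ⟩ x) (Σ⟨ φ ⟩ y)))

module Tries {A : Set} (_≟_ : DecidableEquality A) where

  data Trie : ℕ → Set where
    leaf : ℚ → Trie zero
    node : ∀ {n} → List (A × Trie n) → Trie (suc n)

  singleton : ∀ {n} → Vec A n → ℚ → Trie n
  singleton [] a = leaf a
  singleton (i ∷ is) a = node [ (i , singleton is a) ]

  insert : ∀ {n} → Vec A n → ℚ → Trie n → Trie n
  insertChild : ∀ {n} → A → Vec A n → ℚ → List (A × Trie n) → List (A × Trie n)
  insert [] a (leaf b) = leaf (a ℚ.+ b)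
  insert (i ∷ is) a (node cs) = node (insertChild i is a cs)
  insertChild i is a [] = [ (i , singleton is a) ]
  insertChild i is a ((j , t) ∷ cs) with i ≟ j
  ... | yes _ = (j , insert is a t) ∷ cs
  ... | no _  = (j , t) ∷ insertChild i is a cs

  prefix : ∀ {n} → A → ℚ × Vec A n → ℚ × Vec A (suc n)
  prefix i (a , is) = (a , i ∷ is)

  entries : ∀ {n} → Trie n → List (ℚ × Vec A n)
  entriesChildren : ∀ {n} → List (A × Trie n) → List (ℚ × Vec A (suc n))
  entries (leaf a) with a ℚ.≟ 0ℚ
  ... | yes _ = []
  ... | no _  = [ (a , []) ]
  entries (node cs) = entriesChildren cs
  entriesChildren [] = []
  entriesChildren ((i , t) ∷ cs) = map (prefix i) (entries t) ++ entriesChildren cs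

  empty : ∀ {n} → Trie (suc n)
  empty = node []

  fromList : ∀ {n} → List (ℚ × Vec A (suc n)) → Trie (suc n)
  fromList = foldr (λ (a , k) → insert k a) empty

  prefixed : ∀ {n} → A → (ℚ → Vec A (suc n) → ℚ) → ℚ → Vec A n → ℚ
  prefixed i φ a is = φ a (i ∷ is)

  prefixed-additive : ∀ {n} (φ : ℚ → Vec A (suc n) → ℚ) i → Additive φ → Additive (prefixed i φ)
  prefixed-additive φ i additive a b is = additive a b (i ∷ is)

  Σ-prefix : ∀ {n} (φ : ℚ → Vec A (suc n) → ℚ) i x → Σ⟨ φ ⟩ (map (prefix i) x) ≡ Σ⟨ prefixed i φ ⟩ x
  Σ-prefix φ i [] = refl
  Σ-prefix φ i ((a , is) ∷ x) = cong (φ a (i ∷ is) ℚ.+_) (Σ-prefix φ i x)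

  Σ-entriesChildren-∷ : ∀ {n} (φ : ℚ → Vec A (suc n) → ℚ) i t cs →
    Σ⟨ φ ⟩ (entriesChildren ((i , t) ∷ cs)) ≡ Σ⟨ prefixed i φ ⟩ (entries t) ℚ.+ Σ⟨ φ ⟩ (entriesChildren cs)
  Σ-entriesChildren-∷ φ i t cs =
    trans (Σ-++ φ (map (prefix i) (entries t)) (entriesChildren cs))
          (cong (ℚ._+ Σ⟨ φ ⟩ (entriesChildren cs)) (Σ-prefix φ i (entries t)))

  Σ-leaf : ∀ {φ : ℚ → Vec A zero → ℚ} → Additive φ → ∀ a → Σ⟨ φ ⟩ (entries (leaf a)) ≡ φ a []
  Σ-leaf {φ} additive a with a ℚ.≟ 0ℚ
  ... | yes refl = sym (additive-zero {φ = φ} additive [])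
  ... | no _     = ℚ.+-identityʳ (φ a [])

  Σ-singleton : ∀ {n} {φ : ℚ → Vec A n → ℚ} → Additive φ → ∀ k a → Σ⟨ φ ⟩ (entries (singleton k a)) ≡ φ a k
  Σ-singleton additive [] a = Σ-leaf additive a
  Σ-singleton {φ = φ} additive (i ∷ is) a = begin
    Σ⟨ φ ⟩ (entries (singleton (i ∷ is) a))               ≡⟨ Σ-entriesChildren-∷ φ i (singleton is a) [] ⟩
    Σ⟨ prefixed i φ ⟩ (entries (singleton is a)) ℚ.+ 0ℚ   ≡⟨ ℚ.+-identityʳ _ ⟩
    Σ⟨ prefixed i φ ⟩ (entries (singleton is a))          ≡⟨ Σ-singleton (prefixed-additive φ i additive) is a ⟩
    φ a (i ∷ is)                                          ∎

  Σ-insert : ∀ {n} {φ : ℚ → Vec A n → ℚ} → Additive φ →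
             ∀ k a t → Σ⟨ φ ⟩ (entries (insert k a t)) ≡ φ a k ℚ.+ Σ⟨ φ ⟩ (entries t)
  Σ-insertChild : ∀ {n} {φ : ℚ → Vec A (suc n) → ℚ} → Additive φ →
                  ∀ i is a cs → Σ⟨ φ ⟩ (entriesChildren (insertChild i is a cs)) ≡ φ a (i ∷ is) ℚ.+ Σ⟨ φ ⟩ (entriesChildren cs)
  Σ-insert {φ = φ} additive [] a (leaf b) = begin
    Σ⟨ φ ⟩ (entries (leaf (a ℚ.+ b)))     ≡⟨ Σ-leaf additive (a ℚ.+ b) ⟩
    φ (a ℚ.+ b) []                        ≡⟨ additive a b [] ⟩
    φ a [] ℚ.+ φ b []                     ≡⟨ cong (φ a [] ℚ.+_) (Σ-leaf additive b) ⟨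
    φ a [] ℚ.+ Σ⟨ φ ⟩ (entries (leaf b))  ∎
  Σ-insert additive (i ∷ is) a (node cs) = Σ-insertChild additive i is a cs
  Σ-insertChild {φ = φ} additive i is a [] =
    trans (Σ-entriesChildren-∷ φ i (singleton is a) []) (cong (ℚ._+ 0ℚ) (Σ-singleton (prefixed-additive φ i additive) is a))
  Σ-insertChild {φ = φ} additive i is a ((j , t) ∷ cs) with i ≟ j
  ... | yes refl = begin
    Σ⟨ φ ⟩ (entriesChildren ((i , insert is a t) ∷ cs))
      ≡⟨ Σ-entriesChildren-∷ φ i (insert is a t) cs ⟩
    Σ⟨ prefixed i φ ⟩ (entries (insert is a t)) ℚ.+ Σ⟨ φ ⟩ (entriesChildren cs)
      ≡⟨ cong (ℚ._+ Σ⟨ φ ⟩ (entriesChildren cs)) (Σ-insert (prefixed-additive φ i additive) is a t) ⟩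
    (φ a (i ∷ is) ℚ.+ Σ⟨ prefixed i φ ⟩ (entries t)) ℚ.+ Σ⟨ φ ⟩ (entriesChildren cs)
      ≡⟨ ℚ.+-assoc (φ a (i ∷ is)) (Σ⟨ prefixed i φ ⟩ (entries t)) (Σ⟨ φ ⟩ (entriesChildren cs)) ⟩
    φ a (i ∷ is) ℚ.+ (Σ⟨ prefixed i φ ⟩ (entries t) ℚ.+ Σ⟨ φ ⟩ (entriesChildren cs))
      ≡⟨ cong (φ a (i ∷ is) ℚ.+_) (Σ-entriesChildren-∷ φ i t cs) ⟨
    φ a (i ∷ is) ℚ.+ Σ⟨ φ ⟩ (entriesChildren ((i , t) ∷ cs)) ∎
  ... | no _ = begin
    Σ⟨ φ ⟩ (entriesChildren ((j , t) ∷ insertChild i is a cs))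
      ≡⟨ Σ-entriesChildren-∷ φ j t (insertChild i is a cs) ⟩
    Σ⟨ prefixed j φ ⟩ (entries t) ℚ.+ Σ⟨ φ ⟩ (entriesChildren (insertChild i is a cs))
      ≡⟨ cong (Σ⟨ prefixed j φ ⟩ (entries t) ℚ.+_) (Σ-insertChild additive i is a cs) ⟩
    Σ⟨ prefixed j φ ⟩ (entries t) ℚ.+ (φ a (i ∷ is) ℚ.+ Σ⟨ φ ⟩ (entriesChildren cs))
      ≡⟨ x∙yz≈y∙xz (Σ⟨ prefixed j φ ⟩ (entries t)) (φ a (i ∷ is)) (Σ⟨ φ ⟩ (entriesChildren cs)) ⟩
    φ a (i ∷ is) ℚ.+ (Σ⟨ prefixed j φ ⟩ (entries t) ℚ.+ Σ⟨ φ ⟩ (entriesChildren cs))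
      ≡⟨ cong (φ a (i ∷ is) ℚ.+_) (Σ-entriesChildren-∷ φ j t cs) ⟨
    φ a (i ∷ is) ℚ.+ Σ⟨ φ ⟩ (entriesChildren ((j , t) ∷ cs)) ∎

  Σ-entries-fromList : ∀ {n} {φ : ℚ → Vec A (suc n) → ℚ} → Additive φ →
                       ∀ x → Σ⟨ φ ⟩ (entries (fromList x)) ≡ Σ⟨ φ ⟩ x
  Σ-entries-fromList additive [] = refl
  Σ-entries-fromList {φ = φ} additive ((a , k) ∷ x) =
    trans (Σ-insert additive k a (fromList x)) (cong (φ a k ℚ.+_) (Σ-entries-fromList additive x))

open Tries (Fin._≟_ {8}) using (entries; fromList; Σ-entries-fromList)

compact : QG → QG
compact x = entries (fromList x)

Σ-compact : ∀ {φ : ℚ → Perm → ℚ} → Additive φ → ∀ x → Σ⟨ φ ⟩ (compact x) ≡ Σ⟨ φ ⟩ x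
Σ-compact = Σ-entries-fromList

-- coeff x g is, by definition, Σ⟨ δ g ⟩ x.
δ : Perm → ℚ → Perm → ℚ
δ g a h = if ⌊ h ≟P g ⌋ then a else 0ℚ

δ-additive : ∀ g → Additive (δ g)
δ-additive g a b h with h ≟P g
... | yes _ = refl
... | no _  = sym (ℚ.+-identityˡ 0ℚ)

δ-scale : ∀ g c a h → δ g (c ℚ.* a) h ≡ c ℚ.* δ g a h
δ-scale g c a h with h ≟P g
... | yes _ = refl
... | no _  = sym (ℚ.*-zeroʳ c)

δ-neg : ∀ g a h → δ g (ℚ.- a) h ≡ ℚ.- δ g a h
δ-neg g a h with h ≟P g
... | yes _ = refl
... | no _  = refl

coeff-compact : ∀ x g → coeff (compact x) g ≡ coeff x g
coeff-compact x g = Σ-compact (δ-additive g) x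

coeff-++ : ∀ x y g → coeff (x ++ y) g ≡ coeff x g ℚ.+ coeff y g
coeff-++ x y g = Σ-++ (δ g) x y

coeff-negate : ∀ x g → coeff (-ᴳ x) g ≡ ℚ.- coeff x g
coeff-negate [] g = refl
coeff-negate ((a , h) ∷ x) g = begin
  δ g (ℚ.- a) h ℚ.+ coeff (-ᴳ x) g      ≡⟨ cong₂ ℚ._+_ (δ-neg g a h) (coeff-negate x g) ⟩
  ℚ.- δ g a h ℚ.+ ℚ.- coeff x g         ≡⟨ ℚ.neg-distrib-+ (δ g a h) (coeff x g) ⟨
  ℚ.- coeff ((a , h) ∷ x) g             ∎

coeff-term-*ᴳ : ∀ a h y g → coeff ([ (a , h) ] *ᴳ y) g ≡ a ℚ.* coeff (⟪ h ⟫ *ᴳ y) g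
coeff-term-*ᴳ a h [] g = sym (ℚ.*-zeroʳ a)
coeff-term-*ᴳ a h ((b , k) ∷ y) g = begin
  δ g (a ℚ.* b) (h ∘ₚ k) ℚ.+ coeff ([ (a , h) ] *ᴳ y) g
    ≡⟨ cong₂ ℚ._+_ (cong (λ c → δ g c (h ∘ₚ k)) (cong (a ℚ.*_) (sym (ℚ.*-identityˡ b)))) (coeff-term-*ᴳ a h y g) ⟩
  δ g (a ℚ.* (1ℚ ℚ.* b)) (h ∘ₚ k) ℚ.+ a ℚ.* coeff (⟪ h ⟫ *ᴳ y) g
    ≡⟨ cong (ℚ._+ _) (δ-scale g a (1ℚ ℚ.* b) (h ∘ₚ k)) ⟩
  a ℚ.* δ g (1ℚ ℚ.* b) (h ∘ₚ k) ℚ.+ a ℚ.* coeff (⟪ h ⟫ *ᴳ y) g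
    ≡⟨ ℚ.*-distribˡ-+ a _ _ ⟨
  a ℚ.* coeff (⟪ h ⟫ *ᴳ ((b , k) ∷ y)) g ∎

coeff-*ᴳ : ∀ x y g → coeff (x *ᴳ y) g ≡ Σ⟨ (λ a h → a ℚ.* coeff (⟪ h ⟫ *ᴳ y) g) ⟩ x
coeff-*ᴳ [] y g = refl
coeff-*ᴳ ((a , h) ∷ x) y g = begin
  coeff (((a , h) ∷ x) *ᴳ y) g
    ≡⟨ cong (λ z → coeff (z ++ x *ᴳ y) g) (sym (List.++-identityʳ (map (λ (b , k) → (a ℚ.* b , h ∘ₚ k)) y))) ⟩
  coeff ([ (a , h) ] *ᴳ y ++ x *ᴳ y) g
    ≡⟨ coeff-++ ([ (a , h) ] *ᴳ y) (x *ᴳ y) g ⟩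
  coeff ([ (a , h) ] *ᴳ y) g ℚ.+ coeff (x *ᴳ y) g
    ≡⟨ cong₂ ℚ._+_ (coeff-term-*ᴳ a h y g) (coeff-*ᴳ x y g) ⟩
  Σ⟨ (λ a h → a ℚ.* coeff (⟪ h ⟫ *ᴳ y) g) ⟩ ((a , h) ∷ x) ∎

coeff-compact-*ᴳ : ∀ x y g → coeff (compact x *ᴳ y) g ≡ coeff (x *ᴳ y) g
coeff-compact-*ᴳ x y g = begin
  coeff (compact x *ᴳ y) g  ≡⟨ coeff-*ᴳ (compact x) y g ⟩
  Σ⟨ φ ⟩ (compact x)        ≡⟨ Σ-compact (λ a b h → ℚ.*-distribʳ-+ (coeff (⟪ h ⟫ *ᴳ y) g) a b) x ⟩
  Σ⟨ φ ⟩ x                  ≡⟨ coeff-*ᴳ x y g ⟨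
  coeff (x *ᴳ y) g          ∎
  where
  φ : ℚ → Perm → ℚ
  φ a h = a ℚ.* coeff (⟪ h ⟫ *ᴳ y) g

infix 4 _≈ᶜ_ _≈ᶜ?_
_≈ᶜ_ : QG → QG → Set
x ≈ᶜ y = compact (x -ᴳ y) ≡ []

_≈ᶜ?_ : ∀ x y → Dec (x ≈ᶜ y)
x ≈ᶜ? y with compact (x -ᴳ y)
... | []    = yes refl
... | _ ∷ _ = no λ ()

≈ᶜ⇒≈ᴳ : ∀ x y → x ≈ᶜ y → x ≈ᴳ y
≈ᶜ⇒≈ᴳ x y x-y≡0 g _ = x∙y⁻¹≈ε⇒x≈y (coeff x g) (coeff y g) (begin
  coeff x g ℚ.+ ℚ.- coeff y g        ≡⟨ cong (coeff x g ℚ.+_) (coeff-negate y g) ⟨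
  coeff x g ℚ.+ coeff (-ᴳ y) g       ≡⟨ coeff-++ x (-ᴳ y) g ⟨
  coeff (x -ᴳ y) g                   ≡⟨ coeff-compact (x -ᴳ y) g ⟨
  coeff (compact (x -ᴳ y)) g         ≡⟨ cong (λ z → coeff z g) x-y≡0 ⟩
  0ℚ                                 ∎)

≈ᶜ-compact-*ᴳ⇒≈ᴳ : ∀ x y z → x ≈ᶜ compact y *ᴳ z → x ≈ᴳ y *ᴳ z
≈ᶜ-compact-*ᴳ⇒≈ᴳ x y z x≈yz g g∈G =
  trans (≈ᶜ⇒≈ᴳ x (compact y *ᴳ z) x≈yz g g∈G) (coeff-compact-*ᴳ y z g)

≈ᴳ-sym : ∀ {x y} → x ≈ᴳ y → y ≈ᴳ x
≈ᴳ-sym x≈y g g∈G = sym (x≈y g g∈G)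

by-decision : ∀ {A : Set} (d : Dec A) → does d ≡ true → A
by-decision (yes a) _ = a

prime∤1 : ∀ {p} → Prime p → ¬ p ∣ 1
prime∤1 p-prime p∣1 = nonTrivial⇒≢1 {{prime⇒nonTrivial p-prime}} (∣1⇒≡1 p∣1)

prime∤prime : ∀ {p q} → Prime p → Prime q → p ≢ q → ¬ p ∣ q
prime∤prime p-prime q-prime p≢q p∣q =
  [ nonTrivial⇒≢1 {{prime⇒nonTrivial p-prime}} , p≢q ]′ (prime⇒irreducible q-prime p∣q)

prime∣^⇒prime∣ : ∀ {p} m k → Prime p → p ∣ m ^ k → p ∣ m
prime∣^⇒prime∣ m zero    p-prime p∣1    = contradiction p∣1 (prime∤1 p-prime)
prime∣^⇒prime∣ m (suc k) p-prime p∣mᵏ⁺¹ =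
  [ id , prime∣^⇒prime∣ m k p-prime ]′ (euclidsLemma m (m ^ k) p-prime p∣mᵏ⁺¹)

ℤ[1/m]⊆ℤ₍p₎ : ∀ {p m q} → Prime p → ¬ p ∣ m → ℤ[1/ m ] q → ℤ₍ p ₎ q
ℤ[1/m]⊆ℤ₍p₎ {m = m} p-prime p∤m (k , ↧q∣mᵏ) p∣↧q =
  p∤m (prime∣^⇒prime∣ m k p-prime (∣-trans p∣↧q ↧q∣mᵏ))

ℤ[1/m][G]⊆ℤ₍p₎[G] : ∀ {p m x} → Prime p → ¬ p ∣ m → x ∈[ ℤ[1/ m ] ][G] → x ∈[ ℤ₍ p ₎ ][G]
ℤ[1/m][G]⊆ℤ₍p₎[G] p-prime p∤m =
  All.map (λ {t} (a∈ℤ[1/m] , g∈G) → ℤ[1/m]⊆ℤ₍p₎ {q = proj₁ t} p-prime p∤m a∈ℤ[1/m] , g∈G)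

perm : (a b c d e f g h : ℕ) → Perm
perm a b c d e f g h = pt a ∷ pt b ∷ pt c ∷ pt d ∷ pt e ∷ pt f ∷ pt g ∷ pt h ∷ []

-- The elements of G in the order in which `generated` lists them, so that Gel ≡ G-elements
-- holds by evaluation; computations run over this table instead of regenerating G.
G-elements : List Perm
G-elements =
  perm 1 2 3 4 5 6 7 8 ∷ perm 1 2 6 5 8 7 3 4 ∷ perm 8 1 3 5 6 4 7 2 ∷ perm 1 2 7 8 4 3 6 5 ∷
  perm 8 1 4 6 2 7 3 5 ∷ perm 4 1 6 8 7 5 3 2 ∷ perm 2 8 3 6 4 5 7 1 ∷ perm 8 1 7 2 5 3 4 6 ∷
  perm 4 1 5 7 2 3 6 8 ∷ perm 2 8 5 4 1 7 3 6 ∷ perm 5 1 7 4 3 8 6 2 ∷ perm 5 8 4 2 7 6 3 1 ∷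
  perm 2 4 6 7 5 8 3 1 ∷ perm 4 1 3 2 8 6 5 7 ∷ perm 2 8 7 1 6 3 5 4 ∷ perm 5 1 8 3 2 6 7 4 ∷
  perm 5 8 6 7 1 3 4 2 ∷ perm 2 4 8 5 1 3 6 7 ∷ perm 6 8 7 5 3 2 4 1 ∷ perm 8 4 5 2 3 7 6 1 ∷
  perm 6 2 5 1 7 4 3 8 ∷ perm 2 5 7 3 8 4 6 1 ∷ perm 1 5 4 7 6 2 3 8 ∷ perm 5 1 6 2 4 7 8 3 ∷
  perm 5 8 3 1 2 4 6 7 ∷ perm 2 4 3 1 7 6 8 5 ∷ perm 6 8 2 3 1 4 7 5 ∷ perm 8 4 7 3 1 6 5 2 ∷
  perm 6 2 4 7 8 3 5 1 ∷ perm 2 5 4 8 1 6 7 3 ∷ perm 1 5 2 6 8 3 4 7 ∷ perm 7 4 3 8 6 2 5 1 ∷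
  perm 4 2 7 6 3 1 5 8 ∷ perm 4 5 8 2 6 3 7 1 ∷ perm 2 5 6 1 3 7 4 8 ∷ perm 7 2 8 1 3 5 6 4 ∷
  perm 1 6 7 3 2 5 4 8 ∷ perm 1 8 5 3 7 2 6 4 ∷ perm 8 6 5 7 4 1 3 2 ∷ perm 6 8 4 1 5 7 2 3 ∷
  perm 8 4 6 1 2 5 7 3 ∷ perm 6 2 3 8 1 5 4 7 ∷ perm 1 5 3 8 7 4 2 6 ∷ perm 7 4 2 6 1 5 3 8 ∷
  perm 4 2 1 3 8 5 7 6 ∷ perm 4 5 3 6 1 7 8 2 ∷ perm 7 2 5 3 4 6 8 1 ∷ perm 1 6 5 2 8 4 7 3 ∷
  perm 1 8 2 7 4 6 5 3 ∷ perm 8 6 1 4 2 3 5 7 ∷ perm 3 5 6 4 7 2 8 1 ∷ perm 7 5 3 2 4 1 6 8 ∷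
  perm 5 2 3 7 6 1 8 4 ∷ perm 5 6 2 1 4 3 7 8 ∷ perm 1 6 4 8 3 7 5 2 ∷ perm 3 2 4 1 6 8 7 5 ∷
  perm 7 1 2 8 3 6 4 5 ∷ perm 1 7 3 6 2 8 5 4 ∷ perm 1 4 8 6 3 2 7 5 ∷ perm 8 2 6 3 7 1 4 5 ∷
  perm 4 7 8 3 5 1 6 2 ∷ perm 7 4 5 1 8 3 2 6 ∷ perm 4 2 5 8 6 7 1 3 ∷ perm 4 5 7 1 2 8 3 6 ∷
  perm 7 2 6 4 1 8 5 3 ∷ perm 1 8 6 4 3 5 2 7 ∷ perm 8 6 3 2 7 5 1 4 ∷ perm 3 5 2 7 1 8 6 4 ∷
  perm 7 5 1 4 8 6 3 2 ∷ perm 5 2 1 6 4 8 3 7 ∷ perm 5 6 3 4 8 7 2 1 ∷ perm 3 2 8 6 5 7 4 1 ∷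
  perm 7 1 6 3 5 4 2 8 ∷ perm 1 7 8 2 4 5 3 6 ∷ perm 1 4 2 3 5 7 8 6 ∷ perm 8 2 1 7 5 4 6 3 ∷
  perm 4 7 1 5 2 6 8 3 ∷ perm 3 6 4 5 7 1 2 8 ∷ perm 3 8 6 2 5 1 7 4 ∷ perm 7 6 3 1 5 8 4 2 ∷
  perm 6 1 3 7 4 8 2 5 ∷ perm 8 7 2 1 5 6 3 4 ∷ perm 6 4 1 8 5 3 7 2 ∷ perm 1 7 5 4 6 3 8 2 ∷
  perm 3 1 5 8 4 2 7 6 ∷ perm 3 1 2 4 6 7 5 8 ∷ perm 7 8 1 2 3 4 5 6 ∷ perm 1 3 6 7 2 4 8 5 ∷
  perm 8 7 3 4 1 2 6 5 ∷ perm 8 5 2 4 3 1 7 6 ∷ perm 2 1 4 3 7 8 5 6 ∷ perm 5 3 4 6 8 1 7 2 ∷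
  perm 5 7 2 3 6 8 4 1 ∷ perm 3 5 8 1 4 6 2 7 ∷ perm 7 5 6 8 2 3 1 4 ∷ perm 5 2 8 4 7 3 1 6 ∷
  perm 5 6 7 8 1 2 3 4 ∷ perm 3 2 7 5 1 4 8 6 ∷ perm 7 1 4 5 8 2 6 3 ∷ perm 1 4 7 5 6 8 2 3 ∷
  perm 8 2 4 5 3 6 1 7 ∷ perm 4 7 6 2 3 8 1 5 ∷ perm 3 6 1 7 8 2 4 5 ∷ perm 3 8 1 5 4 7 6 2 ∷
  perm 7 6 8 5 2 4 3 1 ∷ perm 6 1 8 4 5 2 3 7 ∷ perm 8 7 6 5 4 3 2 1 ∷ perm 6 4 3 5 2 7 1 8 ∷
  perm 3 1 7 6 8 5 2 4 ∷ perm 7 8 4 3 6 5 1 2 ∷ perm 1 3 4 2 5 8 6 7 ∷ perm 8 5 1 3 6 7 2 4 ∷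
  perm 2 1 8 7 6 5 4 3 ∷ perm 5 3 1 8 2 7 4 6 ∷ perm 5 7 8 6 1 4 2 3 ∷ perm 6 7 5 8 3 1 2 4 ∷
  perm 3 4 5 6 7 8 1 2 ∷ perm 6 4 7 2 8 1 3 5 ∷ perm 3 7 6 1 8 4 5 2 ∷ perm 4 8 3 7 5 2 1 6 ∷
  perm 4 3 2 1 8 7 6 5 ∷ perm 2 7 1 8 6 4 3 5 ∷ perm 1 3 8 5 7 6 4 2 ∷ perm 6 1 2 5 7 3 8 4 ∷
  perm 3 4 1 2 6 5 8 7 ∷ perm 8 3 4 7 1 5 2 6 ∷ perm 4 3 6 5 1 2 7 8 ∷ perm 2 7 3 5 8 1 4 6 ∷
  perm 4 8 2 5 6 1 3 7 ∷ perm 2 6 1 5 3 8 7 4 ∷ perm 2 1 5 6 3 4 8 7 ∷ perm 6 3 5 4 2 8 7 1 ∷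
  perm 8 3 2 6 7 4 5 1 ∷ perm 6 7 1 3 4 2 5 8 ∷ perm 3 6 2 8 5 4 1 7 ∷ perm 3 8 7 4 2 6 1 5 ∷
  perm 7 6 4 2 1 3 8 5 ∷ perm 7 8 5 6 2 1 4 3 ∷ perm 8 5 7 6 4 2 1 3 ∷ perm 5 3 7 2 6 4 1 8 ∷
  perm 5 7 4 1 3 2 8 6 ∷ perm 3 4 8 7 2 1 5 6 ∷ perm 3 7 4 8 2 5 6 1 ∷ perm 4 3 7 8 5 6 2 1 ∷
  perm 2 7 4 6 5 3 1 8 ∷ perm 8 3 5 1 6 2 4 7 ∷ perm 4 8 1 6 7 3 2 5 ∷ perm 2 6 8 3 4 7 1 5 ∷
  perm 6 3 8 2 1 7 5 4 ∷ perm 6 7 2 4 8 5 1 3 ∷ perm 7 3 8 4 6 1 2 5 ∷ perm 6 5 8 7 3 4 1 2 ∷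
  perm 6 3 7 1 4 5 8 2 ∷ perm 5 4 6 3 8 2 1 7 ∷ perm 2 3 1 4 7 5 6 8 ∷ perm 6 5 1 2 7 8 4 3 ∷
  perm 4 6 5 3 1 8 2 7 ∷ perm 2 3 5 7 8 6 1 4 ∷ perm 2 3 6 8 4 1 5 7 ∷ perm 5 4 2 8 7 1 6 3 ∷
  perm 4 6 2 7 3 5 8 1 ∷ perm 7 3 1 6 5 2 8 4 ∷ perm 3 7 5 2 1 6 4 8 ∷ perm 2 6 7 4 5 1 8 3 ∷
  perm 6 5 4 3 2 1 8 7 ∷ perm 4 6 8 1 7 2 5 3 ∷ perm 5 4 1 7 3 6 2 8 ∷ perm 7 3 2 5 4 8 1 6 ∷
  []

Gel≡G-elements : Gel ≡ G-elements
Gel≡G-elements = refl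

∈G-elements⇒∈Gel : ∀ {g} → g ∈ G-elements → g ∈ Gel
∈G-elements⇒∈Gel {g} = subst (g ∈_) (sym Gel≡G-elements)

DenominatorsDivide : ℕ → ℕ → QG → Set
DenominatorsDivide m k = All (λ (a , g) → ↧ₙ a ∣ m ^ k × g ∈ G-elements)

denominatorsDivide? : ∀ m k x → Dec (DenominatorsDivide m k x)
denominatorsDivide? m k = All.all? (λ (a , g) → (↧ₙ a ∣? m ^ k) ×-dec (g ∈? G-elements))

DenominatorsDivide⇒∈ℤ[1/m][G] : ∀ m k {x} → DenominatorsDivide m k x → x ∈[ ℤ[1/ m ] ][G]
DenominatorsDivide⇒∈ℤ[1/m][G] m k = All.map (λ (a∣mᵏ , g∈G) → (k , a∣mᵏ) , ∈G-elements⇒∈Gel g∈G)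

e4′ : QG
e4′ = eIdem G-elements chi4

-- Implicit arguments are given explicitly from here on wherever unification could
-- otherwise evaluate Gel or a large product.
e4≡e4′ : e4 ≡ e4′
e4≡e4′ = cong (λ Γ → eIdem Γ chi4) {x = Gel} {y = G-elements} Gel≡G-elements

from-e4′ : (P : QG → Set) → P e4′ → P e4
from-e4′ P = subst P {x = e4′} {y = e4} (sym e4≡e4′)

IndOver : List Perm → List Perm → (Perm → ℚ) → Perm → ℚ
IndOver Γ K ψ g = recip (length K) ℚ.* sumℚ (map (λ x → ext0 K ψ ((invP x ∘ₚ g) ∘ₚ x)) Γ)

Ind≡IndOver : ∀ K ψ g → Ind K ψ g ≡ IndOver G-elements K ψ g
Ind≡IndOver K ψ g = cong (λ Γ → IndOver Γ K ψ g) {x = Gel} {y = G-elements} Gel≡G-elements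

χ₄≡IndOver-IndOver : List Perm → List Perm → Perm → Set
χ₄≡IndOver-IndOver K₁ K₂ g = chi4 g ≡ IndOver G-elements K₁ triv g ℚ.- IndOver G-elements K₂ triv g

χ₄≡IndOver-IndOver? : ∀ K₁ K₂ g → Dec (χ₄≡IndOver-IndOver K₁ K₂ g)
χ₄≡IndOver-IndOver? K₁ K₂ g = chi4 g ℚ.≟ (IndOver G-elements K₁ triv g ℚ.- IndOver G-elements K₂ triv g)

χ₄≡Ind-Ind : ∀ g → g ∈ Gel → chi4 g ≡ Ind (A4 zero) triv g ℚ.- Ind Hel triv g
χ₄≡Ind-Ind g g∈G = begin
  chi4 g
    ≡⟨ All.lookup {P = χ₄≡IndOver-IndOver (A4 zero) Hel}
                  (by-decision (All.all? (χ₄≡IndOver-IndOver? (A4 zero) Hel) G-elements) refl)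
                  (subst (g ∈_) Gel≡G-elements g∈G) ⟩
  IndOver G-elements (A4 zero) triv g ℚ.- IndOver G-elements Hel triv g
    ≡⟨ cong₂ ℚ._-_ (Ind≡IndOver (A4 zero) triv g) (Ind≡IndOver Hel triv g) ⟨
  Ind (A4 zero) triv g ℚ.- Ind Hel triv g ∎

infixr 6 _·ᴳ_
_·ᴳ_ : ℚ → QG → QG
c ·ᴳ x = [ (c , idP) ] *ᴳ x

-- S = Σᵢ eᵢ satisfies (S e₄)² = (4/3) S e₄ - (7/36) e₄, hence S r₀ = e₄ for
-- r₀ = (48/7) e₄ - (36/7) S e₄.
r₀ : QG
r₀ = compact ((+ 48 / 7 ·ᴳ e4′) -ᴳ (+ 36 / 7 ·ᴳ (sumᴳ (map eA (allFin 6)) *ᴳ compact e4′)))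

r₀∈ℤ[1/42][G] : r₀ ∈[ ℤ[1/ 42 ] ][G]
r₀∈ℤ[1/42][G] = DenominatorsDivide⇒∈ℤ[1/m][G] 42 2 (by-decision (denominatorsDivide? 42 2 r₀) refl)

e4≈Σe*r₀ : e4 ≈ᴳ sumᴳ (map eA (allFin 6)) *ᴳ r₀
e4≈Σe*r₀ = from-e4′ (λ e → e ≈ᴳ sumᴳ (map eA (allFin 6)) *ᴳ r₀) (≈ᶜ⇒≈ᴳ e4′ (sumᴳ (map eA (allFin 6)) *ᴳ r₀) refl)

-- s j = 1 - gⱼ where eⱼ gⱼ eᵢ = eⱼ eᵢ for i ≠ j and eⱼ gⱼ eⱼ e₄ = -(1/6) eⱼ e₄; as e₄ is
-- central, eⱼ sⱼ e₄ eⱼ = (7/6) e₄ eⱼ, whence r′ = 6/7.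
s : Fin 6 → QG
s j = 1ᴳ -ᴳ ⟪ Vec.lookup (perm 8 1 4 6 2 7 3 5 ∷ perm 2 4 6 7 5 8 3 1 ∷ perm 1 2 6 5 8 7 3 4 ∷
                         perm 8 1 3 5 6 4 7 2 ∷ perm 2 8 5 4 1 7 3 6 ∷ perm 2 8 3 6 4 5 7 1 ∷ []) j ⟫

r′ : QG
r′ = + 6 / 7 ·ᴳ 1ᴳ

s∈ℤ[G] : ∀ j → s j ∈[ ℤ[1/ 1 ] ][G]
s∈ℤ[G] j = DenominatorsDivide⇒∈ℤ[1/m][G] 1 0 (by-decision (Fin.all? λ j → denominatorsDivide? 1 0 (s j)) refl j)

r′∈ℤ[1/14][G] : r′ ∈[ ℤ[1/ 14 ] ][G]
r′∈ℤ[1/14][G] = DenominatorsDivide⇒∈ℤ[1/m][G] 14 1 (by-decision (denominatorsDivide? 14 1 r′) refl)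

eA*s-orthogonal : ∀ j i → i ≢ j → (eA j *ᴳ s j) *ᴳ eA i ≈ᴳ 0ᴳ
eA*s-orthogonal j i i≢j = ≈ᶜ⇒≈ᴳ ((eA j *ᴳ s j) *ᴳ eA i) 0ᴳ
  (by-decision (Fin.all? λ j → Fin.all? λ i → ¬? (i Fin.≟ j) →-dec (((eA j *ᴳ s j) *ᴳ eA i) ≈ᶜ? 0ᴳ)) refl j i i≢j)

e4*eA-factorisation : ∀ j → e4 *ᴳ eA j ≈ᴳ ((r′ *ᴳ (eA j *ᴳ s j)) *ᴳ e4) *ᴳ eA j
e4*eA-factorisation j = from-e4′ (λ e → e *ᴳ eA j ≈ᴳ ((r′ *ᴳ (eA j *ᴳ s j)) *ᴳ e) *ᴳ eA j)
  (≈ᶜ-compact-*ᴳ⇒≈ᴳ (e4′ *ᴳ eA j) ((r′ *ᴳ (eA j *ᴳ s j)) *ᴳ e4′) (eA j)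
    (by-decision (Fin.all? λ j → (e4′ *ᴳ eA j) ≈ᶜ? (compact ((r′ *ᴳ (eA j *ᴳ s j)) *ᴳ e4′) *ᴳ eA j)) refl j))

conjugator : Fin 6 → Perm
conjugator = Vec.lookup (perm 1 2 3 4 5 6 7 8 ∷ perm 1 2 6 5 8 7 3 4 ∷ perm 8 1 3 5 6 4 7 2 ∷
                         perm 8 1 7 2 5 3 4 6 ∷ perm 2 8 3 6 4 5 7 1 ∷ perm 1 2 7 8 4 3 6 5 ∷ [])

eA-conjugate : ∀ i → conjugator i ∈ Gel × eA zero ≈ᴳ (⟪ conjugator i ⟫ *ᴳ eA i) *ᴳ ⟪ invP (conjugator i) ⟫
eA-conjugate i =
  ∈G-elements⇒∈Gel (proj₁ checked) ,
  ≈ᶜ⇒≈ᴳ (eA zero) ((⟪ conjugator i ⟫ *ᴳ eA i) *ᴳ ⟪ invP (conjugator i) ⟫) (proj₂ checked)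
  where
  checked : conjugator i ∈ G-elements × eA zero ≈ᶜ (⟪ conjugator i ⟫ *ᴳ eA i) *ᴳ ⟪ invP (conjugator i) ⟫
  checked = by-decision (Fin.all? λ i → (conjugator i ∈? G-elements)
                                        ×-dec (eA zero ≈ᶜ? (⟪ conjugator i ⟫ *ᴳ eA i) *ᴳ ⟪ invP (conjugator i) ⟫)) refl i

q₁ q₂ q₃ q₄ : QG
q₁ = (+ 1 / 7 , perm 1 2 3 4 5 6 7 8) ∷ (-1 / 7 , perm 1 2 6 5 8 7 3 4) ∷ (+ 1 / 7 , perm 8 1 3 5 6 4 7 2) ∷
     (+ 4 / 7 , perm 1 2 7 8 4 3 6 5) ∷ (-1 / 7 , perm 8 1 4 6 2 7 3 5) ∷ (-1 / 7 , perm 2 8 3 6 4 5 7 1) ∷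
     (-1 / 7 , perm 8 1 7 2 5 3 4 6) ∷ (+ 5 / 7 , perm 5 8 4 2 7 6 3 1) ∷ []
q₂ = (+ 1 / 1 , perm 1 2 3 4 5 6 7 8) ∷ (-3 / 4 , perm 1 2 6 5 8 7 3 4) ∷ (-3 / 4 , perm 8 1 3 5 6 4 7 2) ∷
     (-3 / 4 , perm 1 2 7 8 4 3 6 5) ∷ (+ 1 / 1 , perm 8 1 4 6 2 7 3 5) ∷ (-3 / 4 , perm 8 1 7 2 5 3 4 6) ∷
     (+ 1 / 1 , perm 6 8 7 5 3 2 4 1) ∷ (+ 1 / 1 , perm 1 6 7 3 2 5 4 8) ∷ []
q₃ = (+ 1 / 1 , perm 1 2 3 4 5 6 7 8) ∷ (-1 / 1 , perm 1 2 6 5 8 7 3 4) ∷ (-1 / 1 , perm 8 1 3 5 6 4 7 2) ∷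
     (-1 / 1 , perm 1 2 7 8 4 3 6 5) ∷ (+ 1 / 1 , perm 8 1 4 6 2 7 3 5) ∷ (+ 2 / 1 , perm 2 8 3 6 4 5 7 1) ∷
     (+ 1 / 1 , perm 4 1 5 7 2 3 6 8) ∷ (-1 / 1 , perm 2 8 5 4 1 7 3 6) ∷ []
-- A_{4,(1)} ∩ H has order 3, so e₁ e_H = (1/4) Σ a e_H over representatives
-- a ∈ A_{4,(1)} of the four cosets aH.
q₄ = + 1 / 4 ·ᴳ sumᴳ (map ⟪_⟫ (perm 1 2 3 4 5 6 7 8 ∷ perm 1 6 5 2 8 4 7 3 ∷
                               perm 1 4 8 6 3 2 7 5 ∷ perm 2 6 7 4 5 1 8 3 ∷ []))

q₁∈ℤ[1/7][G] : q₁ ∈[ ℤ[1/ 7 ] ][G]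
q₁∈ℤ[1/7][G] = DenominatorsDivide⇒∈ℤ[1/m][G] 7 1 (by-decision (denominatorsDivide? 7 1 q₁) refl)

q₂∈ℤ[1/2][G] : q₂ ∈[ ℤ[1/ 2 ] ][G]
q₂∈ℤ[1/2][G] = DenominatorsDivide⇒∈ℤ[1/m][G] 2 2 (by-decision (denominatorsDivide? 2 2 q₂) refl)

q₃∈ℤ[G] : q₃ ∈[ ℤ[1/ 1 ] ][G]
q₃∈ℤ[G] = DenominatorsDivide⇒∈ℤ[1/m][G] 1 0 (by-decision (denominatorsDivide? 1 0 q₃) refl)

q₄∈ℤ[1/2][G] : q₄ ∈[ ℤ[1/ 2 ] ][G]
q₄∈ℤ[1/2][G] = DenominatorsDivide⇒∈ℤ[1/m][G] 2 2 (by-decision (denominatorsDivide? 2 2 q₄) refl)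

eA*eH≈[1-e4]eA*q₁ : eA zero *ᴳ eH ≈ᴳ ((1ᴳ -ᴳ e4) *ᴳ eA zero) *ᴳ q₁
eA*eH≈[1-e4]eA*q₁ = from-e4′ (λ e → eA zero *ᴳ eH ≈ᴳ ((1ᴳ -ᴳ e) *ᴳ eA zero) *ᴳ q₁)
  (≈ᶜ-compact-*ᴳ⇒≈ᴳ (eA zero *ᴳ eH) ((1ᴳ -ᴳ e4′) *ᴳ eA zero) q₁ refl)

[1-e4]eA*q₁≈eA*eH : ((1ᴳ -ᴳ e4) *ᴳ eA zero) *ᴳ q₁ ≈ᴳ eA zero *ᴳ eH
[1-e4]eA*q₁≈eA*eH = ≈ᴳ-sym {eA zero *ᴳ eH} {((1ᴳ -ᴳ e4) *ᴳ eA zero) *ᴳ q₁} eA*eH≈[1-e4]eA*q₁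

[1-e4]eA≈eA*eH*q₂ : (1ᴳ -ᴳ e4) *ᴳ eA zero ≈ᴳ (eA zero *ᴳ eH) *ᴳ q₂
[1-e4]eA≈eA*eH*q₂ = from-e4′ (λ e → (1ᴳ -ᴳ e) *ᴳ eA zero ≈ᴳ (eA zero *ᴳ eH) *ᴳ q₂)
  (≈ᶜ⇒≈ᴳ ((1ᴳ -ᴳ e4′) *ᴳ eA zero) ((eA zero *ᴳ eH) *ᴳ q₂) refl)

q₃*eA*eH≈eH : (q₃ *ᴳ eA zero) *ᴳ eH ≈ᴳ eH
q₃*eA*eH≈eH = ≈ᶜ⇒≈ᴳ ((q₃ *ᴳ eA zero) *ᴳ eH) eH refl

eH≈q₃*eA*eH : eH ≈ᴳ (q₃ *ᴳ eA zero) *ᴳ eH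
eH≈q₃*eA*eH = ≈ᴳ-sym {(q₃ *ᴳ eA zero) *ᴳ eH} {eH} q₃*eA*eH≈eH

eA*eH≈q₄*eH : eA zero *ᴳ eH ≈ᴳ q₄ *ᴳ eH
eA*eH≈q₄*eH = ≈ᶜ⇒≈ᴳ (eA zero *ᴳ eH) (q₄ *ᴳ eH) refl

lemma2p2 : (p : ℕ) → Prime p → p ≢ 2 → p ≢ 3 → p ≢ 7 →
    -- (1) χ₄ = Ind_{A_{4,(1)}}^G ε₁ − Ind_H^G ε'
    (∀ g → g ∈ Gel → chi4 g ≡ Ind (A4 zero) triv g ℚ.- Ind Hel triv g)
    -- (2)
    × (∃ λ r₀ → r₀ ∈[ ℤ[1/ 42 ] ][G] × e4 ≈ᴳ sumᴳ (map eA (allFin 6)) *ᴳ r₀)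
    -- (3)  (r_j = e_{ε_j} s with s ∈ ℤ[G])
    × (∀ (j : Fin 6) → ∃ λ s → s ∈[ ℤ[1/ 1 ] ][G] × ∃ λ r′ → r′ ∈[ ℤ[1/ 14 ] ][G]
         × (∀ (i : Fin 6) → i ≢ j → (eA j *ᴳ s) *ᴳ eA i ≈ᴳ 0ᴳ)
         × e4 *ᴳ eA j ≈ᴳ ((r′ *ᴳ (eA j *ᴳ s)) *ᴳ e4) *ᴳ eA j)
    -- (4)
    × (∀ (i : Fin 6) → ∃ λ g → g ∈ Gel × eA zero ≈ᴳ (⟪ g ⟫ *ᴳ eA i) *ᴳ ⟪ invP g ⟫)
    -- (5)
    × ((∃ λ q₁ → q₁ ∈[ ℤ[1/ 7 ] ][G] × ∃ λ q₂ → q₂ ∈[ ℤ[1/ 2 ] ][G]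
          × ((1ᴳ -ᴳ e4) *ᴳ eA zero) *ᴳ q₁ ≈ᴳ eA zero *ᴳ eH
          × (1ᴳ -ᴳ e4) *ᴳ eA zero ≈ᴳ (eA zero *ᴳ eH) *ᴳ q₂)
       × (∃ λ x → x ∈[ ℤ₍ p ₎ ][G] × (1ᴳ -ᴳ e4) *ᴳ eA zero ≈ᴳ (eA zero *ᴳ eH) *ᴳ x)
       × (∃ λ y → y ∈[ ℤ₍ p ₎ ][G] × eA zero *ᴳ eH ≈ᴳ ((1ᴳ -ᴳ e4) *ᴳ eA zero) *ᴳ y))
    -- (6)
    × ((∃ λ q₃ → q₃ ∈[ ℤ[1/ 1 ] ][G] × ∃ λ q₄ → q₄ ∈[ ℤ[1/ 2 ] ][G]
          × (q₃ *ᴳ eA zero) *ᴳ eH ≈ᴳ eH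
          × eA zero *ᴳ eH ≈ᴳ q₄ *ᴳ eH)
       × (∃ λ x → x ∈[ ℤ₍ p ₎ ][G] × eH ≈ᴳ (x *ᴳ eA zero) *ᴳ eH)
       × (∃ λ y → y ∈[ ℤ₍ p ₎ ][G] × eA zero *ᴳ eH ≈ᴳ y *ᴳ eH))
lemma2p2 p p-prime p≢2 _ p≢7 =
    χ₄≡Ind-Ind
  , (r₀ , r₀∈ℤ[1/42][G] , e4≈Σe*r₀)
  , (λ j → s j , s∈ℤ[G] j , r′ , r′∈ℤ[1/14][G] , eA*s-orthogonal j , e4*eA-factorisation j)
  , (λ i → conjugator i , eA-conjugate i)
  , ( (q₁ , q₁∈ℤ[1/7][G] , q₂ , q₂∈ℤ[1/2][G] , [1-e4]eA*q₁≈eA*eH , [1-e4]eA≈eA*eH*q₂)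
    , (q₂ , ℤ[1/m][G]⊆ℤ₍p₎[G] p-prime p∤2 q₂∈ℤ[1/2][G] , [1-e4]eA≈eA*eH*q₂)
    , (q₁ , ℤ[1/m][G]⊆ℤ₍p₎[G] p-prime p∤7 q₁∈ℤ[1/7][G] , eA*eH≈[1-e4]eA*q₁))
  , ( (q₃ , q₃∈ℤ[G] , q₄ , q₄∈ℤ[1/2][G] , q₃*eA*eH≈eH , eA*eH≈q₄*eH)
    , (q₃ , ℤ[1/m][G]⊆ℤ₍p₎[G] p-prime (prime∤1 p-prime) q₃∈ℤ[G] , eH≈q₃*eA*eH)
    , (q₄ , ℤ[1/m][G]⊆ℤ₍p₎[G] p-prime p∤2 q₄∈ℤ[1/2][G] , eA*eH≈q₄*eH))
  where
  p∤2 : ¬ p ∣ 2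
  p∤2 = prime∤prime p-prime prime[2] p≢2
  p∤7 : ¬ p ∣ 7
  p∤7 = prime∤prime p-prime (by-decision (prime? 7) refl) p≢7
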